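{- Let $f:\mathbb{Z}_{\ge0}\to\mathbb{Z}_{\ge0}$ be nondecreasing and suppose that $G_f(\{y,z\})=y\oplus z$ for all $y,z\in\mathbb{Z}_{\ge0}$ with $y\le f(z)$. Then $f$ satisfies condition (a): for all $z,z'\in\mathbb{Z}_{\ge0}$ and every positive integer $i$, if $\lfloor z/2^i\rfloor=\lfloor z'/2^i\rfloor$ then $\lfloor f(z)/2^{i-1}\rfloor=\lfloor f(z')/2^{i-1}\rfloor$.
   Context: $\oplus$ denotes nim-sum (bitwise XOR). For a nondecreasing $f:\mathbb{Z}_{\ge0}\to\mathbb{Z}_{\ge0}$, positions of the chocolate bar game $CB(f,y,z)$ are pairs $\{y,z\}$ of nonnegative integers with $y\le f(z)$ (the bar has $z+1$ columns, column 0 bitter, column $i$ of height $\min(f(i),y)+1$). Moves: $move_f(\{y,z\})=\{\{v,z\}:v<y\}\cup\{\{\min(y,f(w)),w\}:w<z\}$. Grundy number: $G_f(\{y,z\})=\mathrm{mex}\{G_f(p):p\in move_f(\{y,z\})\}$, mex being the least nonnegative integer not in the set. -}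

module Defs where

open import Data.Nat using (ℕ; zero; suc; _+_; _*_; _^_; _/_; _%_; _≤_; _⊓_; _≟_)
open import Data.Nat.Properties using (m^n≢0)
open import Data.List using (List; []; _∷_; map; upTo; _++_)
open import Data.Nat.ListAction using (sum)
open import Data.List.Membership.DecPropositional _≟_ using (_∈?_)
open import Data.Bool using (Bool; true; false; _xor_; if_then_else_)
open import Relation.Nullary.Decidable using (does)

bit : ℕ → ℕ → Bool
bit a i with (a / 2 ^ i) {{m^n≢0 2 i}} % 2
... | zero = false
... | suc _ = true

toN : Bool → ℕ
toN true = 1
toN false = 0

-- nim-sum (bitwise XOR); bits at positions ≥ a + b are zero for both arguments
_⊕_ : ℕ → ℕ → ℕ
a ⊕ b = sum (map (λ i → 2 ^ i * toN (bit a i xor bit b i)) (upTo (a + b)))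

-- mex: least natural number not in the list (search up to the length suffices)
mexFrom : ℕ → ℕ → List ℕ → ℕ
mexFrom k zero xs = k
mexFrom k (suc n) xs = if does (k ∈? xs) then mexFrom (suc k) n xs else k

mex : List ℕ → ℕ
mex xs = mexFrom 0 (Data.List.length xs) xs

-- Grundy number of {y,z} in CB(f,y,z), computed with fuel (options of {y,z}
-- have strictly smaller y + z, so fuel suc (y + z) is enough).
grundyFuel : (ℕ → ℕ) → ℕ → ℕ → ℕ → ℕ
grundyFuel f zero y z = 0
grundyFuel f (suc n) y z =
  mex (map (λ v → grundyFuel f n v z) (upTo y)
       ++ map (λ w → grundyFuel f n (y ⊓ f w) w) (upTo z))

G : (ℕ → ℕ) → ℕ → ℕ → ℕ
G f y z = grundyFuel f (suc (y + z)) y z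

Nondecreasing : (ℕ → ℕ) → Set
Nondecreasing f = ∀ {m n} → m ≤ n → f m ≤ f n

-- Write x ≫ h for ⌊x / 2^h⌋. It suffices to treat consecutive columns a and a + 1 with
-- a ≫ (i + 1) = (a + 1) ≫ (i + 1), assuming condition (a) already holds for all pairs
-- z ≤ a. Suppose f a ≫ i < f (a + 1) ≫ i, let y₀ be the least number with
-- y₀ ≫ i > f a ≫ i and m = y₀ - 1; then {m, a + 1} and {y₀, a + 1} are positions, and
-- every move to a column w ≤ a lands on {f w, w} from both of them.
-- If y₀ ⊕ (a + 1) < m ⊕ (a + 1), the mex property at {m, a + 1} makes y₀ ⊕ (a + 1) the
-- value of such a move, which is then also a move from {y₀, a + 1} with value equal to
-- its own Grundy number. Otherwise y₀ ⊕ a < y₀ ⊕ (a + 1), so y₀ ⊕ a is the value of a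
-- move from {y₀, a + 1}. Comparing leading differing bits, a move to {v, a + 1} is
-- impossible, and a move to {f w, w} forces, through condition (a) for w and a, the bit
-- of a + 1 that makes m ⊕ (a + 1) exceed y₀ ⊕ (a + 1).

module Submission where

open import Defs
open import Data.Nat using (ℕ; suc; _^_; _/_; _≤_)
open import Data.Nat.Properties using (m^n≢0)
open import Relation.Binary.PropositionalEquality using (_≡_)

open import Data.Bool using (Bool; true; false; _xor_)
open import Data.Bool.Properties using (xor-comm)
open import Data.Empty using (⊥; ⊥-elim)
open import Data.List using (List; applyUpTo; map; upTo; _++_; length)
open import Data.List.Properties using (map-upTo; map-cong-local; length-++; length-map; length-upTo)
open import Data.List.Membership.Propositional using (_∈_; _∉_)
open import Data.List.Membership.Propositional.Properties
  using (∈-++⁻; ∈-++⁺ʳ; ∈-map⁺; ∈-map⁻; ∈-upTo⁺; ∈-upTo⁻)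
open import Data.List.Relation.Unary.All.Properties using (applyUpTo⁺₁)
open import Data.Nat
open import Data.Nat.DivMod
open import Data.Nat.Divisibility using (m∣m*n)
open import Data.Nat.ListAction using (sum)
open import Data.Nat.Properties
open import Data.Nat.Solver using (module +-*-Solver)
open import Data.List.Membership.DecPropositional _≟_ using (_∈?_)
open import Data.Product using (_×_; _,_; ∃-syntax)
open import Data.Sum using (_⊎_; inj₁; inj₂)
open import Function using (_∘_; id; case_of_)
open import Relation.Binary.Definitions using (tri<; tri≈; tri>)
open import Relation.Binary.PropositionalEquality
open import Relation.Nullary using (yes; no)
open +-*-Solver using (solve; _:+_; _:*_; con; _:=_)

-- Binary digits

binary : Bool → ℕ → ℕ
binary b q = toN b + 2 * q

toN-injective : ∀ {b c} → toN b ≡ toN c → b ≡ c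
toN-injective {false} {false} _ = refl
toN-injective {true}  {true}  _ = refl

xor-cancelʳ : ∀ b b′ c → b xor c ≡ b′ xor c → b ≡ b′
xor-cancelʳ false false c _ = refl
xor-cancelʳ true  true  c _ = refl
xor-cancelʳ false true  false ()
xor-cancelʳ false true  true  ()
xor-cancelʳ true  false false ()
xor-cancelʳ true  false true  ()

toN-xor-≤ : ∀ b c → toN (b xor c) ≤ toN b + toN c
toN-xor-≤ false c     = ≤-refl
toN-xor-≤ true  false = ≤-refl
toN-xor-≤ true  true  = z≤n

half-binary : ∀ b q → binary b q / 2 ≡ q
half-binary b q = begin
  binary b q / 2          ≡⟨ +-distrib-/-∣ʳ (toN b) (m∣m*n q) ⟩
  toN b / 2 + 2 * q / 2   ≡⟨ cong₂ _+_ (toN-half b) (cong (_/ 2) (*-comm 2 q)) ⟩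
  0 + q * 2 / 2           ≡⟨ m*n/n≡m q 2 ⟩
  q                       ∎
  where
  open ≡-Reasoning
  toN-half : ∀ b → toN b / 2 ≡ 0
  toN-half false = refl
  toN-half true  = refl

parity-binary : ∀ b q → binary b q % 2 ≡ toN b
parity-binary b q = trans (%-remove-+ʳ (toN b) (m∣m*n q)) (toN-parity b)
  where
  toN-parity : ∀ b → toN b % 2 ≡ toN b
  toN-parity false = refl
  toN-parity true  = refl

binary-injective : ∀ {b c q r} → binary b q ≡ binary c r → b ≡ c × q ≡ r
binary-injective {b} {c} {q} {r} e =
    toN-injective (trans (sym (parity-binary b q)) (trans (cong (_% 2) e) (parity-binary c r)))
  , trans (sym (half-binary b q)) (trans (cong (_/ 2) e) (half-binary c r))

infixl 8 _≫_

_≫_ : ℕ → ℕ → ℕ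
x ≫ zero  = x
x ≫ suc h = (x ≫ h) / 2

≫-≡-/ : ∀ x h → x ≫ h ≡ (x / 2 ^ h) {{m^n≢0 2 h}}
≫-≡-/ x zero    = sym (n/1≡n x)
≫-≡-/ x (suc h) = begin
  (x ≫ h) / 2                              ≡⟨ cong (_/ 2) (≫-≡-/ x h) ⟩
  (x / 2 ^ h) {{2^h≢0}} / 2                ≡⟨ m/n/o≡m/[n*o] x (2 ^ h) 2 {{2^h≢0}} {{_}} {{2^h*2≢0}} ⟩
  (x / (2 ^ h * 2)) {{2^h*2≢0}}            ≡⟨ /-congʳ {{2^h*2≢0}} {{m^n≢0 2 (suc h)}} (*-comm (2 ^ h) 2) ⟩
  (x / 2 ^ suc h) {{m^n≢0 2 (suc h)}}      ∎
  where
  open ≡-Reasoning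
  2^h≢0 : NonZero (2 ^ h)
  2^h≢0 = m^n≢0 2 h
  2^h*2≢0 : NonZero (2 ^ h * 2)
  2^h*2≢0 = m*n≢0 (2 ^ h) 2 {{2^h≢0}}

half-≫ : ∀ x h → (x / 2) ≫ h ≡ x ≫ suc h
half-≫ x zero    = refl
half-≫ x (suc h) = cong (_/ 2) (half-≫ x h)

toN-bit : ∀ x h → toN (bit x h) ≡ (x ≫ h) % 2
toN-bit x h = trans (toN-bit-/ x h) (cong (_% 2) (sym (≫-≡-/ x h)))
  where
  toN-bit-/ : ∀ x h → toN (bit x h) ≡ (x / 2 ^ h) {{m^n≢0 2 h}} % 2
  toN-bit-/ x h with (x / 2 ^ h) {{m^n≢0 2 h}} % 2 | m%n<n ((x / 2 ^ h) {{m^n≢0 2 h}}) 2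
  ... | zero        | _ = refl
  ... | suc zero    | _ = refl
  ... | suc (suc _) | s≤s (s≤s ())

≫-decomp : ∀ x h → x ≫ h ≡ binary (bit x h) (x ≫ suc h)
≫-decomp x h = begin
  x ≫ h                              ≡⟨ m≡m%n+[m/n]*n (x ≫ h) 2 ⟩
  (x ≫ h) % 2 + (x ≫ suc h) * 2      ≡⟨ cong₂ _+_ (sym (toN-bit x h)) (*-comm (x ≫ suc h) 2) ⟩
  binary (bit x h) (x ≫ suc h)       ∎
  where open ≡-Reasoning

≫-decomp-bit : ∀ x h {b} → bit x h ≡ b → x ≫ h ≡ binary b (x ≫ suc h)
≫-decomp-bit x h refl = ≫-decomp x h

bit-≫-cong : ∀ {x y} h → x ≫ h ≡ y ≫ h → bit x h ≡ bit y h
bit-≫-cong {x} {y} h e = toN-injective (trans (toN-bit x h) (trans (cong (_% 2) e) (sym (toN-bit y h))))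

bit-half : ∀ x h → bit (x / 2) h ≡ bit x (suc h)
bit-half x h = toN-injective (begin
  toN (bit (x / 2) h)   ≡⟨ toN-bit (x / 2) h ⟩
  ((x / 2) ≫ h) % 2     ≡⟨ cong (_% 2) (half-≫ x h) ⟩
  (x ≫ suc h) % 2       ≡⟨ toN-bit x (suc h) ⟨
  toN (bit x (suc h))   ∎)
  where open ≡-Reasoning

bit-binary : ∀ b q → bit (binary b q) 0 ≡ b
bit-binary b q = toN-injective (trans (toN-bit (binary b q) 0) (parity-binary b q))

half-≤ : ∀ {x n} → x ≤ suc n → x / 2 ≤ n
half-≤ {x} {n} x≤1+n = ≤-pred (m<n*o⇒m/o<n (s≤s (≤-trans x≤1+n (s≤s (m≤m*n n 2)))))

halving-induction : (P : ℕ → ℕ → Set) → P 0 0 → (∀ x y → P (x / 2) (y / 2) → P x y) →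
  ∀ x y → P x y
halving-induction P base step x y = go (x + y) x y (m≤m+n x y) (m≤n+m y x)
  where
  go : ∀ n x y → x ≤ n → y ≤ n → P x y
  go zero    .0 .0 z≤n z≤n = base
  go (suc n) x  y  x≤n y≤n = step x y (go n (x / 2) (y / 2) (half-≤ x≤n) (half-≤ y≤n))

-- Nim-sum

digit : ℕ → ℕ → ℕ → ℕ
digit x y i = 2 ^ i * toN (bit x i xor bit y i)

digit-suc : ∀ x y i → digit x y (suc i) ≡ 2 * digit (x / 2) (y / 2) i
digit-suc x y i = begin
  2 ^ suc i * toN (bit x (suc i) xor bit y (suc i))
    ≡⟨ cong (λ b → 2 ^ suc i * toN b) (sym (cong₂ _xor_ (bit-half x i) (bit-half y i))) ⟩
  2 * 2 ^ i * toN (bit (x / 2) i xor bit (y / 2) i)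
    ≡⟨ *-assoc 2 (2 ^ i) _ ⟩
  2 * digit (x / 2) (y / 2) i
    ∎
  where open ≡-Reasoning

sum-applyUpTo-double : ∀ (g h : ℕ → ℕ) n → (∀ i → g i ≡ 2 * h i) →
  sum (applyUpTo g n) ≡ 2 * sum (applyUpTo h n)
sum-applyUpTo-double g h zero    g≡2h = refl
sum-applyUpTo-double g h (suc n) g≡2h = begin
  g 0 + sum (applyUpTo (g ∘ suc) n)          ≡⟨ cong₂ _+_ (g≡2h 0) (sum-applyUpTo-double _ _ n (g≡2h ∘ suc)) ⟩
  2 * h 0 + 2 * sum (applyUpTo (h ∘ suc) n)  ≡⟨ *-distribˡ-+ 2 (h 0) _ ⟨
  2 * sum (applyUpTo h (suc n))              ∎
  where open ≡-Reasoning

nimSumBelow : ℕ → ℕ → ℕ → ℕ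
nimSumBelow n x y = sum (applyUpTo (digit x y) n)

nimSumBelow-suc : ∀ n x y →
  nimSumBelow (suc n) x y ≡ binary (bit x 0 xor bit y 0) (nimSumBelow n (x / 2) (y / 2))
nimSumBelow-suc n x y = cong₂ _+_ (*-identityˡ _) (sum-applyUpTo-double _ _ n (digit-suc x y))

nimSumBelow-zero : ∀ n → nimSumBelow n 0 0 ≡ 0
nimSumBelow-zero zero    = refl
nimSumBelow-zero (suc n) = trans (nimSumBelow-suc n 0 0) (cong (2 *_) (nimSumBelow-zero n))

nimSumBelow-stable : ∀ {n m x y} → x ≤ n → y ≤ n → n ≤ m → nimSumBelow m x y ≡ nimSumBelow n x y
nimSumBelow-stable {zero}  {m}     z≤n z≤n _ = nimSumBelow-zero m
nimSumBelow-stable {suc n} {suc m} {x} {y} x≤n y≤n (s≤s n≤m) = begin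
  nimSumBelow (suc m) x y                                     ≡⟨ nimSumBelow-suc m x y ⟩
  binary (bit x 0 xor bit y 0) (nimSumBelow m (x / 2) (y / 2)) ≡⟨ cong (binary (bit x 0 xor bit y 0)) halves-stable ⟩
  binary (bit x 0 xor bit y 0) (nimSumBelow n (x / 2) (y / 2)) ≡⟨ nimSumBelow-suc n x y ⟨
  nimSumBelow (suc n) x y                                     ∎
  where
  open ≡-Reasoning
  halves-stable : nimSumBelow m (x / 2) (y / 2) ≡ nimSumBelow n (x / 2) (y / 2)
  halves-stable = nimSumBelow-stable (half-≤ x≤n) (half-≤ y≤n) n≤m

⊕-nimSumBelow : ∀ {n} x y → x + y ≤ n → x ⊕ y ≡ nimSumBelow n x y
⊕-nimSumBelow x y x+y≤n = trans (cong sum (map-upTo (digit x y) (x + y)))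
  (sym (nimSumBelow-stable (m≤m+n x y) (m≤n+m y x) x+y≤n))

⊕-step : ∀ x y → x ⊕ y ≡ binary (bit x 0 xor bit y 0) ((x / 2) ⊕ (y / 2))
⊕-step x y = begin
  x ⊕ y                                                            ≡⟨ ⊕-nimSumBelow x y (n≤1+n (x + y)) ⟩
  nimSumBelow (suc (x + y)) x y                                    ≡⟨ nimSumBelow-suc (x + y) x y ⟩
  binary (bit x 0 xor bit y 0) (nimSumBelow (x + y) (x / 2) (y / 2)) ≡⟨ cong (binary (bit x 0 xor bit y 0)) (sym halves) ⟩
  binary (bit x 0 xor bit y 0) ((x / 2) ⊕ (y / 2))                 ∎
  where
  open ≡-Reasoning
  halves : (x / 2) ⊕ (y / 2) ≡ nimSumBelow (x + y) (x / 2) (y / 2)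
  halves = ⊕-nimSumBelow (x / 2) (y / 2) (+-mono-≤ (m/n≤m x 2) (m/n≤m y 2))

⊕-binary : ∀ b c q r → binary b q ⊕ binary c r ≡ binary (b xor c) (q ⊕ r)
⊕-binary b c q r = trans (⊕-step (binary b q) (binary c r))
  (cong₂ binary (cong₂ _xor_ (bit-binary b q) (bit-binary c r)) (cong₂ _⊕_ (half-binary b q) (half-binary c r)))

⊕-half : ∀ x y → (x ⊕ y) / 2 ≡ (x / 2) ⊕ (y / 2)
⊕-half x y = trans (cong (_/ 2) (⊕-step x y)) (half-binary (bit x 0 xor bit y 0) ((x / 2) ⊕ (y / 2)))

≫-⊕ : ∀ x y h → (x ⊕ y) ≫ h ≡ (x ≫ h) ⊕ (y ≫ h)
≫-⊕ x y zero    = refl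
≫-⊕ x y (suc h) = trans (cong (_/ 2) (≫-⊕ x y h)) (⊕-half (x ≫ h) (y ≫ h))

⊕-comm : ∀ x y → x ⊕ y ≡ y ⊕ x
⊕-comm = halving-induction (λ x y → x ⊕ y ≡ y ⊕ x) refl λ x y ih → begin
  x ⊕ y                                              ≡⟨ ⊕-step x y ⟩
  binary (bit x 0 xor bit y 0) ((x / 2) ⊕ (y / 2))   ≡⟨ cong₂ binary (xor-comm (bit x 0) (bit y 0)) ih ⟩
  binary (bit y 0 xor bit x 0) ((y / 2) ⊕ (x / 2))   ≡⟨ ⊕-step y x ⟨
  y ⊕ x                                              ∎
  where open ≡-Reasoning

⊕-cancelʳ : ∀ x y z → x ⊕ z ≡ y ⊕ z → x ≡ y
⊕-cancelʳ = halving-induction (λ x y → ∀ z → x ⊕ z ≡ y ⊕ z → x ≡ y) (λ _ _ → refl) step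
  where
  step : ∀ x y → (∀ z → (x / 2) ⊕ z ≡ (y / 2) ⊕ z → x / 2 ≡ y / 2) → ∀ z → x ⊕ z ≡ y ⊕ z → x ≡ y
  step x y ih z e with binary-injective (trans (sym (⊕-step x z)) (trans e (⊕-step y z)))
  ... | low , high = begin
    x                          ≡⟨ ≫-decomp x 0 ⟩
    binary (bit x 0) (x / 2)   ≡⟨ cong₂ binary (xor-cancelʳ (bit x 0) (bit y 0) (bit z 0) low) (ih (z / 2) high) ⟩
    binary (bit y 0) (y / 2)   ≡⟨ ≫-decomp y 0 ⟨
    y                          ∎
    where open ≡-Reasoning

⊕-cancelˡ : ∀ x y z → z ⊕ x ≡ z ⊕ y → x ≡ y
⊕-cancelˡ x y z e = ⊕-cancelʳ x y z (trans (⊕-comm x z) (trans e (⊕-comm z y)))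

m⊕n≤m+n : ∀ m n → m ⊕ n ≤ m + n
m⊕n≤m+n = halving-induction (λ x y → x ⊕ y ≤ x + y) z≤n λ x y ih → begin
  x ⊕ y                                                  ≡⟨ ⊕-step x y ⟩
  binary (bit x 0 xor bit y 0) ((x / 2) ⊕ (y / 2))       ≤⟨ +-mono-≤ (toN-xor-≤ (bit x 0) (bit y 0)) (*-monoʳ-≤ 2 ih) ⟩
  (toN (bit x 0) + toN (bit y 0)) + 2 * (x / 2 + y / 2)  ≡⟨ interchange (toN (bit x 0)) (toN (bit y 0)) (x / 2) (y / 2) ⟩
  binary (bit x 0) (x / 2) + binary (bit y 0) (y / 2)    ≡⟨ cong₂ _+_ (≫-decomp x 0) (≫-decomp y 0) ⟨
  x + y                                                  ∎
  where
  open ≤-Reasoning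
  interchange : ∀ a b c d → (a + b) + 2 * (c + d) ≡ (a + 2 * c) + (b + 2 * d)
  interchange = solve 4 (λ a b c d → (a :+ b) :+ con 2 :* (c :+ d) := (a :+ con 2 :* c) :+ (b :+ con 2 :* d)) refl

-- Shifts and the leading differing bit

≫-mono : ∀ h {x y} → x ≤ y → x ≫ h ≤ y ≫ h
≫-mono zero    x≤y = x≤y
≫-mono (suc h) x≤y = /-monoˡ-≤ 2 (≫-mono h x≤y)

≫-reflects-< : ∀ h {x y} → x ≫ h < y ≫ h → x < y
≫-reflects-< h lt = ≰⇒> (λ y≤x → <⇒≱ lt (≫-mono h y≤x))

≫-≡-mono : ∀ {h k x y} → h ≤ k → x ≫ h ≡ y ≫ h → x ≫ k ≡ y ≫ k
≫-≡-mono {x = x} {y} h≤k e = go (≤⇒≤′ h≤k)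
  where
  go : ∀ {k} → _ ≤′ k → x ≫ k ≡ y ≫ k
  go ≤′-refl        = e
  go (≤′-step h≤′k) = cong (_/ 2) (go h≤′k)

suc-≫-≤ : ∀ x h → suc x ≫ h ≤ suc (x ≫ h)
suc-≫-≤ x zero    = ≤-refl
suc-≫-≤ x (suc h) = ≤-trans (/-monoˡ-≤ 2 (suc-≫-≤ x h)) (suc-half-≤ (x ≫ h))
  where
  suc-half-≤ : ∀ n → suc n / 2 ≤ suc (n / 2)
  suc-half-≤ n = ≤-pred (m<n*o⇒m/o<n {o = 2} (s≤s (s≤s (begin
    n                     ≡⟨ m≡m%n+[m/n]*n n 2 ⟩
    n % 2 + (n / 2) * 2   ≤⟨ +-monoˡ-≤ _ (m%n≤n n 2) ⟩
    2 + (n / 2) * 2       ∎))))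
    where open ≤-Reasoning

≫-*-2^ : ∀ c h → (c * 2 ^ h) ≫ h ≡ c
≫-*-2^ c h = trans (≫-≡-/ (c * 2 ^ h) h) (m*n/n≡m c (2 ^ h) {{m^n≢0 2 h}})

*-2^-≤ : ∀ {c x} h → c ≤ x ≫ h → c * 2 ^ h ≤ x
*-2^-≤ {c} {x} h c≤x≫h = begin
  c * 2 ^ h                             ≤⟨ *-monoˡ-≤ (2 ^ h) c≤x≫h ⟩
  (x ≫ h) * 2 ^ h                       ≡⟨ cong (_* 2 ^ h) (≫-≡-/ x h) ⟩
  (x / 2 ^ h) {{m^n≢0 2 h}} * 2 ^ h     ≤⟨ m/n*n≤m x (2 ^ h) {{m^n≢0 2 h}} ⟩
  x                                     ∎
  where open ≤-Reasoning

<-*-2^⇒≫< : ∀ {c x} h → x < c * 2 ^ h → x ≫ h < c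
<-*-2^⇒≫< {c} {x} h x<c2^h = subst (_< c) (sym (≫-≡-/ x h)) (m<n*o⇒m/o<n {{m^n≢0 2 h}} x<c2^h)

record LeadingDiff (h x y : ℕ) : Set where
  field
    bitˡ  : bit x h ≡ false
    bitʳ  : bit y h ≡ true
    agree : x ≫ suc h ≡ y ≫ suc h

open LeadingDiff

leadingDiff-≢ : ∀ {h x y} → LeadingDiff h x y → x ≫ h ≢ y ≫ h
leadingDiff-≢ {h} d e with trans (sym (bitˡ d)) (trans (bit-≫-cong h e) (bitʳ d))
... | ()

leadingDiff-intro : ∀ {x y} h → x ≤ y → x ≫ h ≢ y ≫ h → x ≫ suc h ≡ y ≫ suc h → LeadingDiff h x y
leadingDiff-intro {x} {y} h x≤y x≢y x≈y = split (bit x h) (bit y h) refl refl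
  where
  same-bit : ∀ {b} → bit x h ≡ b → bit y h ≡ b → x ≫ h ≡ y ≫ h
  same-bit {b} bx by = trans (≫-decomp-bit x h bx) (trans (cong (binary b) x≈y) (sym (≫-decomp-bit y h by)))
  split : ∀ b c → bit x h ≡ b → bit y h ≡ c → LeadingDiff h x y
  split false true  bx by = record { bitˡ = bx ; bitʳ = by ; agree = x≈y }
  split false false bx by = ⊥-elim (x≢y (same-bit bx by))
  split true  true  bx by = ⊥-elim (x≢y (same-bit bx by))
  split true  false bx by = ⊥-elim (1+n≰n (subst₂ _≤_
    (≫-decomp-bit x h bx) (trans (≫-decomp-bit y h by) (cong (binary false) (sym x≈y))) (≫-mono h x≤y)))

leadingDiff-exists : ∀ {x y} → x < y → ∃[ h ] LeadingDiff h x y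
leadingDiff-exists {x} {y} = halving-induction (λ x y → x < y → ∃[ h ] LeadingDiff h x y) (λ ()) step x y
  where
  step : ∀ x y → (x / 2 < y / 2 → ∃[ h ] LeadingDiff h (x / 2) (y / 2)) → x < y → ∃[ h ] LeadingDiff h x y
  step x y ih x<y with x / 2 ≟ y / 2
  ... | yes halves≡ = 0 , leadingDiff-intro 0 (<⇒≤ x<y) (<⇒≢ x<y) halves≡
  ... | no  halves≢ with ih (≤∧≢⇒< (/-monoˡ-≤ 2 (<⇒≤ x<y)) halves≢)
  ...   | h , d = suc h , leadingDiff-intro (suc h) (<⇒≤ x<y)
            (subst₂ _≢_ (half-≫ x h) (half-≫ y h) (leadingDiff-≢ d))
            (subst₂ _≡_ (half-≫ x (suc h)) (half-≫ y (suc h)) (agree d))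

leadingDiff-respˡ : ∀ {h x x′ y} → x ≫ h ≡ x′ ≫ h → LeadingDiff h x y → LeadingDiff h x′ y
leadingDiff-respˡ {h} e d = record
  { bitˡ  = trans (sym (bit-≫-cong h e)) (bitˡ d)
  ; bitʳ  = bitʳ d
  ; agree = trans (sym (cong (_/ 2) e)) (agree d)
  }

leadingDiff-≤ : ∀ {h x y} k → LeadingDiff h x y → x ≫ suc k ≡ y ≫ suc k → h ≤ k
leadingDiff-≤ {h} k d e with h ≤? k
... | yes h≤k = h≤k
... | no  h≰k = ⊥-elim (leadingDiff-≢ d (≫-≡-mono (≰⇒> h≰k) e))

leadingDiff-suc : ∀ {x} h → x ≫ h ≢ suc x ≫ h → bit (suc x) h ≡ true → LeadingDiff h x (suc x)
leadingDiff-suc {x} h x≢1+x b = leadingDiff-intro h (n≤1+n x) x≢1+x (begin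
  (x ≫ h) / 2                       ≡⟨ cong (_/ 2) (suc-injective (trans 1+x≫h (≫-decomp-bit (suc x) h b))) ⟩
  binary false (suc x ≫ suc h) / 2  ≡⟨ half-binary false (suc x ≫ suc h) ⟩
  suc x ≫ suc h                     ∎)
  where
  open ≡-Reasoning
  1+x≫h : suc (x ≫ h) ≡ suc x ≫ h
  1+x≫h = sym (≤-antisym (suc-≫-≤ x h) (≤∧≢⇒< (≫-mono h (n≤1+n x)) x≢1+x))

≫-⊕-bits : ∀ x u h {b c} → bit x h ≡ b → bit u h ≡ c →
  (x ⊕ u) ≫ h ≡ binary (b xor c) ((x ≫ suc h) ⊕ (u ≫ suc h))
≫-⊕-bits x u h {b} {c} bx bu = begin
  (x ⊕ u) ≫ h                                              ≡⟨ ≫-⊕ x u h ⟩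
  (x ≫ h) ⊕ (u ≫ h)                                        ≡⟨ cong₂ _⊕_ (≫-decomp-bit x h bx) (≫-decomp-bit u h bu) ⟩
  binary b (x ≫ suc h) ⊕ binary c (u ≫ suc h)              ≡⟨ ⊕-binary b c (x ≫ suc h) (u ≫ suc h) ⟩
  binary (b xor c) ((x ≫ suc h) ⊕ (u ≫ suc h))             ∎
  where open ≡-Reasoning

leadingDiff-⊕-< : ∀ {h u u′} x → LeadingDiff h u u′ → bit x h ≡ false → x ⊕ u < x ⊕ u′
leadingDiff-⊕-< {h} {u} {u′} x d bx = ≫-reflects-< h (subst₂ _<_
  (sym (≫-⊕-bits x u h bx (bitˡ d)))
  (sym (trans (≫-⊕-bits x u′ h bx (bitʳ d)) (cong (λ s → binary true ((x ≫ suc h) ⊕ s)) (sym (agree d)))))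
  (n<1+n _))

leadingDiff-⊕-> : ∀ {h u u′} x → LeadingDiff h u u′ → bit x h ≡ true → x ⊕ u′ < x ⊕ u
leadingDiff-⊕-> {h} {u} {u′} x d bx = ≫-reflects-< h (subst₂ _<_
  (sym (trans (≫-⊕-bits x u′ h bx (bitʳ d)) (cong (λ s → binary false ((x ≫ suc h) ⊕ s)) (sym (agree d)))))
  (sym (≫-⊕-bits x u h bx (bitˡ d)))
  (n<1+n _))

⊕-≡⇒≫-≡ : ∀ {x y u u′} k → x ⊕ u ≡ y ⊕ u′ → x ≫ k ≡ y ≫ k → u ≫ k ≡ u′ ≫ k
⊕-≡⇒≫-≡ {x} {y} {u} {u′} k e ek = ⊕-cancelˡ (u ≫ k) (u′ ≫ k) (x ≫ k) (begin
  (x ≫ k) ⊕ (u ≫ k)    ≡⟨ ≫-⊕ x u k ⟨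
  (x ⊕ u) ≫ k          ≡⟨ cong (_≫ k) e ⟩
  (y ⊕ u′) ≫ k         ≡⟨ ≫-⊕ y u′ k ⟩
  (y ≫ k) ⊕ (u′ ≫ k)   ≡⟨ cong (_⊕ (u′ ≫ k)) (sym ek) ⟩
  (x ≫ k) ⊕ (u′ ≫ k)   ∎)
  where open ≡-Reasoning

leadingDiff-transfer : ∀ {h x y u u′} → x ⊕ u ≡ y ⊕ u′ → LeadingDiff h x y →
  u ≫ h ≢ u′ ≫ h × u ≫ suc h ≡ u′ ≫ suc h
leadingDiff-transfer {h} {x} {y} {u} {u′} e d =
    (λ u≡u′ → leadingDiff-≢ d (⊕-≡⇒≫-≡ h (trans (⊕-comm u x) (trans e (⊕-comm y u′))) u≡u′))
  , ⊕-≡⇒≫-≡ (suc h) e (agree d)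

-- Grundy values as mex of option values

mexFrom-covers : ∀ n k xs {j} → k ≤ j → j < mexFrom k n xs → j ∈ xs
mexFrom-covers zero    k xs k≤j j<k = ⊥-elim (<⇒≱ j<k k≤j)
mexFrom-covers (suc n) k xs k≤j j<mex with k ∈? xs
... | no  _    = ⊥-elim (<⇒≱ j<mex k≤j)
... | yes k∈xs with m≤n⇒m<n∨m≡n k≤j
...   | inj₂ refl = k∈xs
...   | inj₁ k<j  = mexFrom-covers n (suc k) xs k<j j<mex

mexFrom-∉ : ∀ n k xs → mexFrom k n xs < k + n → mexFrom k n xs ∉ xs
mexFrom-∉ zero    k xs mex<k+0 = ⊥-elim (<-irrefl (sym (+-identityʳ k)) mex<k+0)
mexFrom-∉ (suc n) k xs mex<k+n with k ∈? xs
... | no  k∉xs = k∉xs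
... | yes _    = mexFrom-∉ n (suc k) xs (subst (mexFrom (suc k) n xs <_) (+-suc k n) mex<k+n)

mex-covers : ∀ {xs j} → j < mex xs → j ∈ xs
mex-covers {xs} = mexFrom-covers (length xs) 0 xs z≤n

mex-∉ : ∀ {xs} → mex xs < length xs → mex xs ∉ xs
mex-∉ {xs} = mexFrom-∉ (length xs) 0 xs

module Options (f : ℕ → ℕ) where

  grundyFuel-irrelevant : ∀ {n m y z} → y + z < n → y + z < m → grundyFuel f n y z ≡ grundyFuel f m y z
  grundyFuel-irrelevant {suc n} {suc m} {y} {z} (s≤s y+z≤n) (s≤s y+z≤m) = cong mex (cong₂ _++_
    (map-cong-local (applyUpTo⁺₁ id y λ v<y →
      grundyFuel-irrelevant (<-≤-trans (row v<y) y+z≤n) (<-≤-trans (row v<y) y+z≤m)))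
    (map-cong-local (applyUpTo⁺₁ id z λ w<z →
      grundyFuel-irrelevant (<-≤-trans (column w<z) y+z≤n) (<-≤-trans (column w<z) y+z≤m))))
    where
    row : ∀ {v} → v < y → v + z < y + z
    row = +-monoˡ-< z
    column : ∀ {w} → w < z → y ⊓ f w + w < y + z
    column {w} = +-mono-≤-< (m⊓n≤m y (f w))

  optionValues : ℕ → ℕ → List ℕ
  optionValues y z = map (λ v → G f v z) (upTo y) ++ map (λ w → G f (y ⊓ f w) w) (upTo z)

  G-mex-optionValues : ∀ y z → G f y z ≡ mex (optionValues y z)
  G-mex-optionValues y z = cong mex (cong₂ _++_
    (map-cong-local (applyUpTo⁺₁ id y λ v<y → grundyFuel-irrelevant (+-monoˡ-< z v<y) ≤-refl))
    (map-cong-local (applyUpTo⁺₁ id z λ {w} w<z → grundyFuel-irrelevant (+-mono-≤-< (m⊓n≤m y (f w)) w<z) ≤-refl)))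

  length-optionValues : ∀ y z → length (optionValues y z) ≡ y + z
  length-optionValues y z = trans (length-++ (map (λ v → G f v z) (upTo y)))
    (cong₂ _+_ (trans (length-map _ (upTo y)) (length-upTo y)) (trans (length-map _ (upTo z)) (length-upTo z)))

GrundyIsNimSum : (ℕ → ℕ) → Set
GrundyIsNimSum f = ∀ y z → y ≤ f z → G f y z ≡ y ⊕ z

module _ {f : ℕ → ℕ} (H : GrundyIsNimSum f) where
  open Options f

  below-nimSum-∈-optionValues : ∀ {x y z} → y ≤ f z → x < y ⊕ z → x ∈ optionValues y z
  below-nimSum-∈-optionValues {x} {y} {z} y≤fz x<y⊕z =
    mex-covers (subst (x <_) (trans (sym (H y z y≤fz)) (G-mex-optionValues y z)) x<y⊕z)

  below-nimSum-is-option : ∀ {x y z} → y ≤ f z → x < y ⊕ z →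
    (∃[ v ] v < y × x ≡ v ⊕ z) ⊎ (∃[ w ] w < z × x ≡ (y ⊓ f w) ⊕ w)
  below-nimSum-is-option {x} {y} {z} y≤fz x<y⊕z
    with ∈-++⁻ (map (λ v → G f v z) (upTo y)) (below-nimSum-∈-optionValues y≤fz x<y⊕z)
  ... | inj₁ x∈row with ∈-map⁻ (λ v → G f v z) x∈row
  ...   | v , v∈upTo , x≡ = inj₁ (v , ∈-upTo⁻ v∈upTo , trans x≡ (H v z (≤-trans (<⇒≤ (∈-upTo⁻ v∈upTo)) y≤fz)))
  below-nimSum-is-option {x} {y} {z} y≤fz x<y⊕z | inj₂ x∈column with ∈-map⁻ (λ w → G f (y ⊓ f w) w) x∈column
  ...   | w , w∈upTo , x≡ = inj₂ (w , ∈-upTo⁻ w∈upTo , trans x≡ (H (y ⊓ f w) w (m⊓n≤n y (f w))))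

  nimSum-not-option : ∀ {y z w} → y ≤ f z → w < z → (y ⊓ f w) ⊕ w ≢ y ⊕ z
  nimSum-not-option {y} {z} {w} y≤fz w<z e = mex-∉ mex<length mex∈options
    where
    mex≡ : mex (optionValues y z) ≡ (y ⊓ f w) ⊕ w
    mex≡ = trans (sym (G-mex-optionValues y z)) (trans (H y z y≤fz) (sym e))
    mex∈options : mex (optionValues y z) ∈ optionValues y z
    mex∈options = subst (_∈ optionValues y z) (trans (H (y ⊓ f w) w (m⊓n≤n y (f w))) (sym mex≡))
      (∈-++⁺ʳ (map (λ v → G f v z) (upTo y)) (∈-map⁺ (λ w → G f (y ⊓ f w) w) (∈-upTo⁺ w<z)))
    mex<length : mex (optionValues y z) < length (optionValues y z)
    mex<length = begin-strict
      mex (optionValues y z)       ≡⟨ mex≡ ⟩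
      (y ⊓ f w) ⊕ w                ≤⟨ m⊕n≤m+n (y ⊓ f w) w ⟩
      (y ⊓ f w) + w                <⟨ +-mono-≤-< (m⊓n≤m y (f w)) w<z ⟩
      y + z                        ≡⟨ length-optionValues y z ⟨
      length (optionValues y z)    ∎
      where open ≤-Reasoning

-- Condition (a)

ConditionAUpTo : (ℕ → ℕ) → ℕ → Set
ConditionAUpTo f n = ∀ {z} h → z ≤ n → z ≫ suc h ≡ n ≫ suc h → f z ≫ h ≡ f n ≫ h

module Jump {f : ℕ → ℕ} (mono : Nondecreasing f) (H : GrundyIsNimSum f)
            {a i : ℕ} (ih : ConditionAUpTo f a) (a≈1+a : a ≫ suc i ≡ suc a ≫ suc i)
            (jump : f a ≫ i < f (suc a) ≫ i) where

  A : ℕ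
  A = f a

  m y₀ : ℕ
  m  = pred (suc (A ≫ i) * 2 ^ i)
  y₀ = suc m

  y₀≡ : y₀ ≡ suc (A ≫ i) * 2 ^ i
  y₀≡ = suc-pred _ {{m*n≢0 (suc (A ≫ i)) (2 ^ i) {{_}} {{m^n≢0 2 i}}}}

  y₀≫i : y₀ ≫ i ≡ suc (A ≫ i)
  y₀≫i = trans (cong (_≫ i) y₀≡) (≫-*-2^ (suc (A ≫ i)) i)

  y₀≤f[1+a] : y₀ ≤ f (suc a)
  y₀≤f[1+a] = subst (_≤ f (suc a)) (sym y₀≡) (*-2^-≤ i jump)

  A<y₀ : A < y₀
  A<y₀ = ≫-reflects-< i (subst (A ≫ i <_) (sym y₀≫i) (n<1+n (A ≫ i)))

  m≫i≡A≫i : m ≫ i ≡ A ≫ i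
  m≫i≡A≫i = ≤-antisym (≤-pred (<-*-2^⇒≫< i (subst (m <_) y₀≡ (n<1+n m)))) (≫-mono i (≤-pred A<y₀))

  f-below-A : ∀ {w} → w < suc a → f w ≤ A
  f-below-A w<1+a = mono (≤-pred w<1+a)

  ⊓-f-below : ∀ {x w} → A ≤ x → w < suc a → x ⊓ f w ≡ f w
  ⊓-f-below A≤x w<1+a = m≥n⇒m⊓n≡n (≤-trans (f-below-A w<1+a) A≤x)

  y₀-separated : ∀ {k x} → k ≤ i → x ≫ i ≡ A ≫ i → x ≫ k ≢ y₀ ≫ k
  y₀-separated k≤i x≫i≡A≫i e = 1+n≢n (sym (trans (sym x≫i≡A≫i) (trans (≫-≡-mono k≤i e) y₀≫i)))

  y₀⊕[1+a]≮m⊕[1+a] : y₀ ⊕ suc a ≮ m ⊕ suc a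
  y₀⊕[1+a]≮m⊕[1+a] lt with below-nimSum-is-option H (≤-trans (n≤1+n m) y₀≤f[1+a]) lt
  ... | inj₁ (v , v<m , e) = <-irrefl (sym (⊕-cancelʳ y₀ v (suc a) e)) (<-trans v<m (n<1+n m))
  ... | inj₂ (w , w<1+a , e) = nimSum-not-option H y₀≤f[1+a] w<1+a (begin
    (y₀ ⊓ f w) ⊕ w   ≡⟨ cong (_⊕ w) (trans (⊓-f-below (<⇒≤ A<y₀) w<1+a) (sym (⊓-f-below (≤-pred A<y₀) w<1+a))) ⟩
    (m ⊓ f w) ⊕ w    ≡⟨ e ⟨
    y₀ ⊕ suc a       ∎)
    where open ≡-Reasoning

  module _ (lt : m ⊕ suc a < y₀ ⊕ suc a) where

    no-leadingDiff-m-y₀ : ∀ {h} → LeadingDiff h m y₀ → bit (suc a) h ≢ true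
    no-leadingDiff-m-y₀ d b =
      <-asym lt (subst₂ _<_ (⊕-comm (suc a) y₀) (⊕-comm (suc a) m) (leadingDiff-⊕-> (suc a) d b))

    y₀-bit-false : ∀ {h} → LeadingDiff h a (suc a) → bit y₀ h ≡ false
    y₀-bit-false {h} d with bit y₀ h in b
    ... | false = refl
    ... | true  = ⊥-elim (no-leadingDiff-m-y₀ (leadingDiff-suc h m≢y₀ b) (bitʳ d))
      where
      m≢y₀ : m ≫ h ≢ y₀ ≫ h
      m≢y₀ = y₀-separated (leadingDiff-≤ i d a≈1+a) m≫i≡A≫i

    m⊕[1+a]≮y₀⊕[1+a] : ⊥
    m⊕[1+a]≮y₀⊕[1+a] with leadingDiff-exists (n<1+n a)
    ... | j , dj with below-nimSum-is-option H y₀≤f[1+a] (leadingDiff-⊕-< y₀ dj (y₀-bit-false dj))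
    ...   | inj₁ (v , v<y₀ , e) with leadingDiff-exists v<y₀
    ...     | h , dv with leadingDiff-transfer (sym e) dv
    ...       | 1+a≢a , 1+a≈a
                with trans (sym (y₀-bit-false (leadingDiff-intro h (n≤1+n a) (1+a≢a ∘ sym) (sym 1+a≈a)))) (bitʳ dv)
    ...         | ()
    m⊕[1+a]≮y₀⊕[1+a] | j , dj | inj₂ (w , w<1+a , e) with leadingDiff-exists (≤-<-trans (f-below-A w<1+a) A<y₀)
    ... | h , dw with leadingDiff-transfer (trans (cong (_⊕ w) (sym (⊓-f-below (<⇒≤ A<y₀) w<1+a))) (sym e)) dw
    ...   | w≢a , w≈a = no-leadingDiff-m-y₀ (leadingDiff-respˡ fw≫h≡m≫h dw) 1+a-bit-h
      where
      dwa : LeadingDiff h w a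
      dwa = leadingDiff-intro h (≤-pred w<1+a) w≢a w≈a
      fw≫h≡A≫h : f w ≫ h ≡ A ≫ h
      fw≫h≡A≫h = ih h (≤-pred w<1+a) w≈a
      i≤h : i ≤ h
      i≤h with i ≤? h
      ... | yes i≤h = i≤h
      ... | no  i≰h = ⊥-elim (y₀-separated (≰⇒> i≰h) refl (trans (cong (_/ 2) (sym fw≫h≡A≫h)) (agree dw)))
      j<h : j < h
      j<h = ≤∧≢⇒< (≤-trans (leadingDiff-≤ i dj a≈1+a) i≤h) λ { refl → case trans (sym (bitˡ dj)) (bitʳ dwa) of λ () }
      1+a-bit-h : bit (suc a) h ≡ true
      1+a-bit-h = trans (sym (bit-≫-cong h (≫-≡-mono j<h (agree dj)))) (bitʳ dwa)
      fw≫h≡m≫h : f w ≫ h ≡ m ≫ h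
      fw≫h≡m≫h = trans fw≫h≡A≫h (sym (≫-≡-mono i≤h m≫i≡A≫i))

  impossible : ⊥
  impossible with <-cmp (m ⊕ suc a) (y₀ ⊕ suc a)
  ... | tri< lt _ _ = m⊕[1+a]≮y₀⊕[1+a] lt
  ... | tri≈ _ e _  = <-irrefl (⊕-cancelʳ m y₀ (suc a) e) (n<1+n m)
  ... | tri> _ _ gt = y₀⊕[1+a]≮m⊕[1+a] gt

conditionA-upTo : ∀ {f} → Nondecreasing f → GrundyIsNimSum f → ∀ n → ConditionAUpTo f n
conditionA-upTo mono H zero    {zero} h z≤n _ = refl
conditionA-upTo {f} mono H (suc a) {z} h z≤1+a z≈1+a with m≤n⇒m<n∨m≡n z≤1+a
... | inj₂ refl  = refl
... | inj₁ z<1+a = trans (ih h (≤-pred z<1+a) (trans z≈1+a (sym a≈1+a))) fa≫h≡f[1+a]≫h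
  where
  ih : ConditionAUpTo f a
  ih = conditionA-upTo mono H a
  a≈1+a : a ≫ suc h ≡ suc a ≫ suc h
  a≈1+a = ≤-antisym (≫-mono (suc h) (n≤1+n a)) (subst (_≤ a ≫ suc h) z≈1+a (≫-mono (suc h) (≤-pred z<1+a)))
  fa≫h≡f[1+a]≫h : f a ≫ h ≡ f (suc a) ≫ h
  fa≫h≡f[1+a]≫h with m≤n⇒m<n∨m≡n (≫-mono h (mono (n≤1+n a)))
  ... | inj₁ jump = ⊥-elim (Jump.impossible mono H {i = h} ih a≈1+a jump)
  ... | inj₂ eq   = eq

conditionA : ∀ {f} → Nondecreasing f → GrundyIsNimSum f →
  ∀ {z z′} i → z ≫ suc i ≡ z′ ≫ suc i → f z ≫ i ≡ f z′ ≫ i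
conditionA mono H {z} {z′} i e with ≤-total z z′
... | inj₁ z≤z′ = conditionA-upTo mono H z′ i z≤z′ e
... | inj₂ z′≤z = sym (conditionA-upTo mono H z i z′≤z (sym e))

mainTheorem2 : (f : ℕ → ℕ) → Nondecreasing f →
    (∀ y z → y ≤ f z → G f y z ≡ y ⊕ z) →
    ∀ z z' i →
      (z / 2 ^ suc i) {{m^n≢0 2 (suc i)}} ≡ (z' / 2 ^ suc i) {{m^n≢0 2 (suc i)}} →
      (f z / 2 ^ i) {{m^n≢0 2 i}} ≡ (f z' / 2 ^ i) {{m^n≢0 2 i}}
mainTheorem2 f mono H z z' i e = trans (sym (≫-≡-/ (f z) i)) (trans
  (conditionA mono H i (trans (≫-≡-/ z (suc i)) (trans e (sym (≫-≡-/ z' (suc i))))))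
  (≫-≡-/ (f z') i))
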